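{- Let $(\mathcal{B},\nu)$ be an effective topology with a recursively enumerable subset relation, and let $\phi$ be an oracle for a point $x$ in $(\mathcal{B},\nu)$. Then there exists a nested oracle $\psi$ for $x$ in $(\mathcal{B},\nu)$ that is recursive relative to $\phi$ uniformly.
   Context: Let $X$ be a set with a topology having a countable basis $\mathcal{B}$. A coding of $\mathcal{B}$ is a (not necessarily injective) assignment $n\mapsto\nu(n)$ of basis elements to non-negative integers, every basis element being coded by at least one integer; $\mathrm{dom}_{\mathcal{B}}\nu$ denotes the set of $n$ with $\nu(n)\in\mathcal{B}$. $(\mathcal{B},\nu)$ is an effective topology iff $\mathcal{B}$ is a countable basis for a $T_0$ topology and $\nu$ is a coding of $\mathcal{B}$. A set $\mathcal{L}_x\subseteq\mathcal{B}$ is a local basis for $x$ iff every member contains $x$ and every $B\in\mathcal{B}$ containing $x$ has a subset in $\mathcal{L}_x$. With $\mathbb{N}$ the non-negative integers, a function $\phi:\mathbb{N}\to\mathrm{dom}_{\mathcal{B}}\nu$ is an oracle for $x$ iff $\{\nu(\phi(n)):n\in\mathbb{N}\}$ is a local basis for $x$; it is nested iff $\nu(\phi(n+1))\subseteq\nu(\phi(n))$ for all $n$. The subset relation is recursively enumerable iff $\{\langle b_1,b_2\rangle: b_1,b_2\in\mathrm{dom}_{\mathcal{B}}\nu,\ \nu(b_1)\subseteq\nu(b_2)\}$ is recursively enumerable (Cantor pairing). "Recursive relative to $\phi$ uniformly" means computed from $\phi$ by an oracle Turing machine not depending on $\phi$. -}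

module Defs where

open import Data.Nat using (ℕ; zero; suc; _+_)
open import Data.Fin using (Fin)
open import Data.Vec using (Vec; []; _∷_; lookup)
open import Data.Product using (Σ; ∃; _×_; _,_)
open import Data.Sum using (_⊎_)
open import Relation.Nullary using (¬_)
open import Relation.Binary.PropositionalEquality using (_≡_; _≢_)
open import Function.Bundles using (_⇔_)

-- Model of computation: partial recursive functions with an oracle
-- (equivalent to oracle Turing machines).

data PR : ℕ → Set where
  zer    : ∀ {n} → PR n
  succ   : PR 1
  proj   : ∀ {n} → Fin n → PR n
  orc    : PR 1
  comp   : ∀ {m n} → PR m → Vec (PR n) m → PR n
  prim   : ∀ {n} → PR n → PR (suc (suc n)) → PR (suc n)
  mu     : ∀ {n} → PR (suc n) → PR n

mutual
  data Eval (f : ℕ → ℕ) : ∀ {n} → PR n → Vec ℕ n → ℕ → Set where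
    e-zer  : ∀ {n} {xs : Vec ℕ n} → Eval f zer xs 0
    e-succ : ∀ {x} → Eval f succ (x ∷ []) (suc x)
    e-proj : ∀ {n} {i : Fin n} {xs} → Eval f (proj i) xs (lookup xs i)
    e-orc  : ∀ {x} → Eval f orc (x ∷ []) (f x)
    e-comp : ∀ {m n} {g : PR m} {hs : Vec (PR n) m} {xs ys y} →
             EvalAll f hs xs ys → Eval f g ys y → Eval f (comp g hs) xs y
    e-prim-z : ∀ {n} {h : PR n} {g} {xs y} →
             Eval f h xs y → Eval f (prim h g) (0 ∷ xs) y
    e-prim-s : ∀ {n} {h : PR n} {g} {k xs r y} →
             Eval f (prim h g) (k ∷ xs) r → Eval f g (k ∷ r ∷ xs) y →
             Eval f (prim h g) (suc k ∷ xs) y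
    e-mu   : ∀ {n} {g : PR (suc n)} {xs y} →
             MuFrom f g xs 0 y → Eval f (mu g) xs y

  data EvalAll (f : ℕ → ℕ) {n : ℕ} : ∀ {m} → Vec (PR n) m → Vec ℕ n → Vec ℕ m → Set where
    ea-[] : ∀ {xs} → EvalAll f [] xs []
    ea-∷  : ∀ {m} {h : PR n} {hs : Vec (PR n) m} {xs y ys} →
            Eval f h xs y → EvalAll f hs xs ys → EvalAll f (h ∷ hs) xs (y ∷ ys)

  data MuFrom (f : ℕ → ℕ) {n : ℕ} (g : PR (suc n)) (xs : Vec ℕ n) : ℕ → ℕ → Set where
    mu-found : ∀ {k} → Eval f g (k ∷ xs) 0 → MuFrom f g xs k k
    mu-step  : ∀ {k v y} → Eval f g (k ∷ xs) (suc v) →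
               MuFrom f g xs (suc k) y → MuFrom f g xs k y

-- A set of naturals is recursively enumerable iff it is the domain of a
-- partial recursive function (no oracle: the oracle is the constant 0).
RE : (ℕ → Set) → Set
RE S = Σ (PR 1) λ e → ∀ n → S n ⇔ (∃ λ y → Eval (λ _ → 0) e (n ∷ []) y)

-- Cantor pairing  ⟨a , b⟩ = (a+b)(a+b+1)/2 + b
tri : ℕ → ℕ
tri zero    = 0
tri (suc k) = suc k + tri k

pair : ℕ → ℕ → ℕ
pair a b = tri (a + b) + b

-- Effective topologies.  The basis is given through its coding:
-- dom n says n ∈ dom_B ν, and then ν n : X → Set is the basis element
-- coded by n; B = { ν n | dom n }.

_⊆_ : {X : Set} → (X → Set) → (X → Set) → Set
U ⊆ V = ∀ {x} → U x → V x

record EffectiveTopology (X : Set) : Set₁ where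
  field
    dom : ℕ → Set
    ν   : ℕ → X → Set
    cover : ∀ x → ∃ λ n → dom n × ν n x
    inter : ∀ a b x → dom a → dom b → ν a x → ν b x →
            ∃ λ c → dom c × ν c x × (ν c ⊆ ν a) × (ν c ⊆ ν b)
    t0    : ∀ x y → x ≢ y → ∃ λ n → dom n ×
            ((ν n x × ¬ ν n y) ⊎ (ν n y × ¬ ν n x))

module _ {X : Set} (T : EffectiveTopology X) where
  open EffectiveTopology T

  SubsetCodes : ℕ → Set
  SubsetCodes k = ∃ λ b₁ → ∃ λ b₂ → k ≡ pair b₁ b₂ × dom b₁ × dom b₂ × (ν b₁ ⊆ ν b₂)

  SubsetRE : Set
  SubsetRE = RE SubsetCodes

  IsOracle : X → (ℕ → ℕ) → Set
  IsOracle x φ = (∀ n → dom (φ n) × ν (φ n) x) ×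
                 (∀ b → dom b → ν b x → ∃ λ n → ν (φ n) ⊆ ν b)

  Nested : (ℕ → ℕ) → Set
  Nested ψ = ∀ n → ν (ψ (suc n)) ⊆ ν (ψ n)

-- Let e enumerate the codes ⟨u , w⟩ with ν u ⊆ ν w, and put ψ 0 = φ 0.  Given ψ n = a, the
-- intersection ν a ∩ ν (φ (n + 1)) contains a basic neighbourhood of x and hence some ν (φ m);
-- so e eventually halts on both ⟨φ m , a⟩ and ⟨φ m , φ (n + 1)⟩.  Running e for t steps is
-- primitive recursive in t (runᴾ), so a single minimisation over t finds such an m, and
-- ψ (n + 1) = φ m is contained in ψ n and in φ (n + 1): ψ is nested and, refining φ, an oracle.
module Submission where

open import Defs
open import Data.Nat using (ℕ; zero; suc; _+_; pred; _≤_; _<_; _⊔_; z≤n; s≤s)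
open import Data.Nat.Properties
open import Data.Fin using (Fin; zero; suc; #_; _↑ʳ_)
open import Data.Vec using (Vec; []; _∷_; _++_; lookup; tabulate; map)
open import Data.Vec.Properties using (lookup-++ʳ; tabulate∘lookup; tabulate-cong; map-∘; map-id)
open import Data.Product using (Σ; ∃; _×_; _,_; proj₁; proj₂)
open import Data.Sum using (inj₁; inj₂)
open import Data.Empty using (⊥-elim)
open import Relation.Binary.PropositionalEquality
open import Relation.Binary.Definitions using (tri<; tri≈; tri>)
open import Function.Bundles using (_⇔_; Equivalence)

ifZero : ℕ → ℕ → ℕ → ℕ
ifZero zero    a b = a
ifZero (suc _) a b = b

guard : ℕ → ℕ → ℕ
guard zero    a = 0
guard (suc _) a = a

guardAll : ∀ {m} → Vec ℕ m → ℕ → ℕ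
guardAll []       r = r
guardAll (v ∷ vs) r = guard v (guardAll vs r)

guardAll-map-suc : ∀ {m} (ys : Vec ℕ m) r → guardAll (map suc ys) r ≡ r
guardAll-map-suc []       r = refl
guardAll-map-suc (y ∷ ys) r = guardAll-map-suc ys r

map-pred-suc : ∀ {m} (ys : Vec ℕ m) → map pred (map suc ys) ≡ ys
map-pred-suc ys = trans (sym (map-∘ pred suc ys)) (map-id ys)

tri-mono-≤ : ∀ {s s′} → s ≤ s′ → tri s ≤ tri s′
tri-mono-≤ {s} {zero}   z≤n = ≤-refl
tri-mono-≤ {s} {suc s′} s≤1+s′ with m≤n⇒m<n∨m≡n s≤1+s′
... | inj₂ refl = ≤-refl
... | inj₁ s<1+s′ = ≤-trans (tri-mono-≤ (m<1+n⇒m≤n s<1+s′)) (m≤n+m (tri s′) (suc s′))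

-- tri s + s < tri (1 + s), so pairs on an earlier diagonal come first.
pair-<-diagonal : ∀ a b c d → a + b < c + d → pair a b < pair c d
pair-<-diagonal a b c d lt =
  ≤-<-trans (+-monoʳ-≤ (tri (a + b)) (m≤n+m b a))
    (<-≤-trans (s≤s (≤-reflexive (+-comm (tri (a + b)) (a + b))))
      (≤-trans (tri-mono-≤ lt) (m≤m+n (tri (c + d)) d)))

pair-injective : ∀ a b c d → pair a b ≡ pair c d → a ≡ c × b ≡ d
pair-injective a b c d eq with <-cmp (a + b) (c + d)
... | tri< lt _ _ = ⊥-elim (<-irrefl eq (pair-<-diagonal a b c d lt))
... | tri> _ _ gt = ⊥-elim (<-irrefl (sym eq) (pair-<-diagonal c d a b gt))
... | tri≈ _ same-diagonal _ = a≡c , b≡d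
  where
  b≡d : b ≡ d
  b≡d = +-cancelˡ-≡ (tri (a + b)) b d (trans eq (cong (λ s → tri s + d) (sym same-diagonal)))
  a≡c : a ≡ c
  a≡c = +-cancelʳ-≡ b a c (trans same-diagonal (cong (c +_) (sym b≡d)))

app₁ : ∀ {n} → PR 1 → PR n → PR n
app₁ g a = comp g (a ∷ [])

app₂ : ∀ {n} → PR 2 → PR n → PR n → PR n
app₂ g a b = comp g (a ∷ b ∷ [])

app₃ : ∀ {n} → PR 3 → PR n → PR n → PR n → PR n
app₃ g a b c = comp g (a ∷ b ∷ c ∷ [])

projs : ∀ {m n} → (Fin m → Fin n) → Vec (PR n) m
projs ρ = tabulate (λ i → proj (ρ i))

dropᴾ : ∀ k {n} → Vec (PR (k + n)) n
dropᴾ k = projs (k ↑ʳ_)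

oneᴾ : ∀ {n} → PR n
oneᴾ = app₁ succ zer

predᴾ : PR 1
predᴾ = prim zer (proj (# 0))

guardᴾ : PR 2
guardᴾ = prim zer (proj (# 2))

ifZeroᴾ : PR 3
ifZeroᴾ = prim (proj (# 0)) (proj (# 3))

addᴾ : PR 2
addᴾ = prim (proj (# 0)) (app₁ succ (proj (# 1)))

triᴾ : PR 1
triᴾ = prim zer (app₂ addᴾ (app₁ succ (proj (# 0))) (proj (# 1)))

pairᴾ : PR 2
pairᴾ = app₂ addᴾ (app₁ triᴾ (app₂ addᴾ (proj (# 0)) (proj (# 1)))) (proj (# 1))

guardAllᴾ : ∀ m → PR (suc m)
guardAllᴾ zero    = proj zero
guardAllᴾ (suc m) = app₂ guardᴾ (proj (# 1)) (comp (guardAllᴾ m) (proj zero ∷ dropᴾ 2))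

predsᴾ : ∀ {n m} → Vec (PR n) m → Vec (PR n) m
predsᴾ = map (app₁ predᴾ)

module _ {f : ℕ → ℕ} where

  app₁-eval : ∀ {n} {g : PR 1} {a : PR n} {xs u y} →
    Eval f a xs u → Eval f g (u ∷ []) y → Eval f (app₁ g a) xs y
  app₁-eval ea eg = e-comp (ea-∷ ea ea-[]) eg

  app₂-eval : ∀ {n} {g : PR 2} {a b : PR n} {xs u v y} →
    Eval f a xs u → Eval f b xs v → Eval f g (u ∷ v ∷ []) y → Eval f (app₂ g a b) xs y
  app₂-eval ea eb eg = e-comp (ea-∷ ea (ea-∷ eb ea-[])) eg

  app₃-eval : ∀ {n} {g : PR 3} {a b c : PR n} {xs u v w y} →
    Eval f a xs u → Eval f b xs v → Eval f c xs w → Eval f g (u ∷ v ∷ w ∷ []) y →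
    Eval f (app₃ g a b c) xs y
  app₃-eval ea eb ec eg = e-comp (ea-∷ ea (ea-∷ eb (ea-∷ ec ea-[]))) eg

  prim-eval : ∀ {n} {h : PR n} {g : PR (suc (suc n))} xs (F : ℕ → ℕ) →
    Eval f h xs (F 0) → (∀ k → Eval f g (k ∷ F k ∷ xs) (F (suc k))) →
    ∀ k → Eval f (prim h g) (k ∷ xs) (F k)
  prim-eval xs F h0 gs zero    = e-prim-z h0
  prim-eval xs F h0 gs (suc k) = e-prim-s (prim-eval xs F h0 gs k) (gs k)

  projs-eval : ∀ {m n} (ρ : Fin m → Fin n) xs →
    EvalAll f (projs ρ) xs (tabulate (λ i → lookup xs (ρ i)))
  projs-eval {zero}  ρ xs = ea-[]
  projs-eval {suc m} ρ xs = ea-∷ e-proj (projs-eval (λ i → ρ (suc i)) xs)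

  dropᴾ-eval : ∀ {k n} (ys : Vec ℕ k) (xs : Vec ℕ n) → EvalAll f (dropᴾ k) (ys ++ xs) xs
  dropᴾ-eval {k} ys xs = subst (EvalAll f (dropᴾ k) (ys ++ xs))
    (trans (tabulate-cong (lookup-++ʳ ys xs)) (tabulate∘lookup xs)) (projs-eval (k ↑ʳ_) (ys ++ xs))

  oneᴾ-eval : ∀ {n} {xs : Vec ℕ n} → Eval f oneᴾ xs 1
  oneᴾ-eval = app₁-eval e-zer e-succ

  predᴾ-eval : ∀ {k} → Eval f predᴾ (k ∷ []) (pred k)
  predᴾ-eval {k} = prim-eval [] pred e-zer (λ _ → e-proj) k

  guardᴾ-eval : ∀ {c a} → Eval f guardᴾ (c ∷ a ∷ []) (guard c a)
  guardᴾ-eval {c} {a} = prim-eval (a ∷ []) (λ c → guard c a) e-zer (λ _ → e-proj) c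

  ifZeroᴾ-eval : ∀ {c a b} → Eval f ifZeroᴾ (c ∷ a ∷ b ∷ []) (ifZero c a b)
  ifZeroᴾ-eval {c} {a} {b} = prim-eval (a ∷ b ∷ []) (λ c → ifZero c a b) e-proj (λ _ → e-proj) c

  addᴾ-eval : ∀ {a b} → Eval f addᴾ (a ∷ b ∷ []) (a + b)
  addᴾ-eval {a} {b} = prim-eval (b ∷ []) (_+ b) e-proj (λ _ → app₁-eval e-proj e-succ) a

  triᴾ-eval : ∀ {a} → Eval f triᴾ (a ∷ []) (tri a)
  triᴾ-eval {a} = prim-eval [] tri e-zer (λ _ → app₂-eval (app₁-eval e-proj e-succ) e-proj addᴾ-eval) a

  pairᴾ-eval : ∀ {a b} → Eval f pairᴾ (a ∷ b ∷ []) (pair a b)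
  pairᴾ-eval = app₂-eval (app₁-eval (app₂-eval e-proj e-proj addᴾ-eval) triᴾ-eval) e-proj addᴾ-eval

  guardAllᴾ-eval : ∀ {m} r (vs : Vec ℕ m) → Eval f (guardAllᴾ m) (r ∷ vs) (guardAll vs r)
  guardAllᴾ-eval r []       = e-proj
  guardAllᴾ-eval r (v ∷ vs) =
    app₂-eval e-proj (e-comp (ea-∷ e-proj (dropᴾ-eval (r ∷ v ∷ []) vs)) (guardAllᴾ-eval r vs)) guardᴾ-eval

  predsᴾ-eval : ∀ {n m} {qs : Vec (PR n) m} {xs vs} → EvalAll f qs xs vs → EvalAll f (predsᴾ qs) xs (map pred vs)
  predsᴾ-eval ea-[]       = ea-[]
  predsᴾ-eval (ea-∷ e es) = ea-∷ (app₁-eval e predᴾ-eval) (predsᴾ-eval es)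

  mu-least : ∀ {n} {g : PR (suc n)} {xs} y → Eval f g (y ∷ xs) 0 →
    (∀ z → z < y → ∃ λ v → Eval f g (z ∷ xs) (suc v)) → MuFrom f g xs 0 y
  mu-least {g = g} {xs} y at-y below-y = from 0 y refl
    where
    from : ∀ k d → k + d ≡ y → MuFrom f g xs k y
    from k zero    k+0≡y rewrite +-identityʳ k | k+0≡y = mu-found at-y
    from k (suc d) eq =
      mu-step (proj₂ (below-y k (subst (k <_) eq (m<m+n k (s≤s z≤n)))))
              (from (suc k) d (trans (sym (+-suc k d)) eq))

  mu-search : ∀ {n} {g : PR (suc n)} {xs} (G : ℕ → ℕ) → (∀ z → Eval f g (z ∷ xs) (G z)) →
    ∀ k d → G (k + d) ≡ 0 → ∃ λ y → MuFrom f g xs k y × G y ≡ 0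
  mu-search {g = g} {xs} G eval-G k zero Gz =
    let Gk = subst (λ i → G i ≡ 0) (+-identityʳ k) Gz
    in k , mu-found (subst (Eval f g (k ∷ xs)) Gk (eval-G k)) , Gk
  mu-search {g = g} {xs} G eval-G k (suc d) Gz with G k in Gk
  ... | zero  = k , mu-found (subst (Eval f g (k ∷ xs)) Gk (eval-G k)) , Gk
  ... | suc v with mu-search G eval-G (suc k) d (subst (λ i → G i ≡ 0) (+-suc k d) Gz)
  ...   | y , found , Gy = y , mu-step (subst (Eval f g (k ∷ xs)) Gk (eval-G k)) found , Gy

primRun : ℕ → (ℕ → ℕ → ℕ) → ℕ → ℕ
primRun z s zero    = z
primRun z s (suc k) = guard (primRun z s k) (s k (pred (primRun z s k)))

-- States of a bounded search: 0 aborted, 1 still searching, 2 + y found y.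
muStep : ℕ → ℕ → ℕ → ℕ
muStep j zero          v             = 0
muStep j (suc zero)    zero          = 0
muStep j (suc zero)    (suc zero)    = 2 + j
muStep j (suc zero)    (suc (suc _)) = 1
muStep j (suc (suc y)) v             = 2 + y

muState : (ℕ → ℕ) → ℕ → ℕ
muState V zero    = 1
muState V (suc j) = muStep j (muState V j) (V j)

-- run p t xs is suc y when p, with every oracle query answered by 0 and every
-- minimisation cut off at t, halts with output y; it is 0 otherwise.
mutual
  run : ∀ {n} → PR n → ℕ → Vec ℕ n → ℕ
  run zer         t xs       = 1
  run succ        t (x ∷ []) = 2 + x
  run (proj i)    t xs       = suc (lookup xs i)
  run orc         t xs       = 1
  run (comp g hs) t xs       = guardAll (runAll hs t xs) (run g t (map pred (runAll hs t xs)))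
  run (prim h g)  t (k ∷ xs) = primRun (run h t xs) (λ j r → run g t (j ∷ r ∷ xs)) k
  run (mu g)      t xs       = pred (muState (λ j → run g t (j ∷ xs)) t)

  runAll : ∀ {n m} → Vec (PR n) m → ℕ → Vec ℕ n → Vec ℕ m
  runAll []       t xs = []
  runAll (h ∷ hs) t xs = run h t xs ∷ runAll hs t xs

muStepᴾ : PR 3
muStepᴾ = app₃ ifZeroᴾ (proj (# 1)) zer
  (app₃ ifZeroᴾ (app₁ predᴾ (proj (# 1)))
    (app₃ ifZeroᴾ (proj (# 2)) zer
      (app₃ ifZeroᴾ (app₁ predᴾ (proj (# 2))) (app₁ succ (app₁ succ (proj (# 0)))) oneᴾ))
    (proj (# 1)))

muStep-ifZero : ∀ j s v →
  ifZero s 0 (ifZero (pred s) (ifZero v 0 (ifZero (pred v) (2 + j) 1)) s) ≡ muStep j s v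
muStep-ifZero j zero          v             = refl
muStep-ifZero j (suc zero)    zero          = refl
muStep-ifZero j (suc zero)    (suc zero)    = refl
muStep-ifZero j (suc zero)    (suc (suc v)) = refl
muStep-ifZero j (suc (suc s)) v             = refl

primRunStepᴾ : ∀ {n} → PR (suc (suc (suc n))) → PR (suc (suc (suc n)))
primRunStepᴾ s = app₂ guardᴾ (proj (# 1)) (comp s (proj (# 2) ∷ proj (# 0) ∷ app₁ predᴾ (proj (# 1)) ∷ dropᴾ 3))

primRunᴾ : ∀ {n} → PR (suc n) → PR (suc (suc (suc n))) → PR (suc (suc n))
primRunᴾ z s = comp (prim z (primRunStepᴾ s)) (proj (# 1) ∷ proj (# 0) ∷ dropᴾ 2)

muSearchStepᴾ : ∀ {n} → PR (suc (suc n)) → PR (suc (suc (suc n)))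
muSearchStepᴾ q = app₃ muStepᴾ (proj (# 0)) (proj (# 1)) (comp q (proj (# 2) ∷ proj (# 0) ∷ dropᴾ 3))

muSearchᴾ : ∀ {n} → PR (suc (suc n)) → PR (suc n)
muSearchᴾ q = app₁ predᴾ (comp (prim oneᴾ (muSearchStepᴾ q)) (proj (# 0) ∷ proj (# 0) ∷ dropᴾ 1))

mutual
  runᴾ : ∀ {n} → PR n → PR (suc n)
  runᴾ zer                = oneᴾ
  runᴾ succ               = app₁ succ (app₁ succ (proj (# 1)))
  runᴾ (proj i)           = app₁ succ (proj (suc i))
  runᴾ orc                = oneᴾ
  runᴾ (comp {m} g hs)    = comp (guardAllᴾ m) (comp (runᴾ g) (proj zero ∷ predsᴾ (runAllᴾ hs)) ∷ runAllᴾ hs)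
  runᴾ (prim h g)         = primRunᴾ (runᴾ h) (runᴾ g)
  runᴾ (mu g)             = muSearchᴾ (runᴾ g)

  runAllᴾ : ∀ {n m} → Vec (PR n) m → Vec (PR (suc n)) m
  runAllᴾ []       = []
  runAllᴾ (h ∷ hs) = runᴾ h ∷ runAllᴾ hs

module _ {f : ℕ → ℕ} where

  muStepᴾ-eval : ∀ {j s v} → Eval f muStepᴾ (j ∷ s ∷ v ∷ []) (muStep j s v)
  muStepᴾ-eval {j} {s} {v} = subst (Eval f muStepᴾ (j ∷ s ∷ v ∷ [])) (muStep-ifZero j s v)
    (app₃-eval e-proj e-zer
      (app₃-eval (app₁-eval e-proj predᴾ-eval)
        (app₃-eval e-proj e-zer
          (app₃-eval (app₁-eval e-proj predᴾ-eval) (app₁-eval (app₁-eval e-proj e-succ) e-succ) oneᴾ-eval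
            ifZeroᴾ-eval)
          ifZeroᴾ-eval)
        e-proj ifZeroᴾ-eval)
      ifZeroᴾ-eval)

  primRunStepᴾ-eval : ∀ {n} {s : PR (suc (suc (suc n)))} j r t (xs : Vec ℕ n) {S : ℕ → ℕ → ℕ} →
    (∀ j r → Eval f s (t ∷ j ∷ r ∷ xs) (S j r)) →
    Eval f (primRunStepᴾ s) (j ∷ r ∷ t ∷ xs) (guard r (S j (pred r)))
  primRunStepᴾ-eval j r t xs eval-s =
    app₂-eval e-proj
      (e-comp (ea-∷ e-proj (ea-∷ e-proj (ea-∷ (app₁-eval e-proj predᴾ-eval) (dropᴾ-eval (j ∷ r ∷ t ∷ []) xs))))
              (eval-s j (pred r)))
      guardᴾ-eval

  primRunᴾ-eval : ∀ {n} {z : PR (suc n)} {s} t k (xs : Vec ℕ n) {Z} {S : ℕ → ℕ → ℕ} →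
    Eval f z (t ∷ xs) Z → (∀ j r → Eval f s (t ∷ j ∷ r ∷ xs) (S j r)) →
    Eval f (primRunᴾ z s) (t ∷ k ∷ xs) (primRun Z S k)
  primRunᴾ-eval t k xs {Z} {S} eval-z eval-s =
    e-comp (ea-∷ e-proj (ea-∷ e-proj (dropᴾ-eval (t ∷ k ∷ []) xs)))
      (prim-eval (t ∷ xs) (primRun Z S) eval-z (λ j → primRunStepᴾ-eval j (primRun Z S j) t xs eval-s) k)

  muSearchStepᴾ-eval : ∀ {n} {q : PR (suc (suc n))} j s t (xs : Vec ℕ n) {V : ℕ → ℕ} →
    (∀ j → Eval f q (t ∷ j ∷ xs) (V j)) → Eval f (muSearchStepᴾ q) (j ∷ s ∷ t ∷ xs) (muStep j s (V j))
  muSearchStepᴾ-eval j s t xs eval-q =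
    app₃-eval e-proj e-proj
      (e-comp (ea-∷ e-proj (ea-∷ e-proj (dropᴾ-eval (j ∷ s ∷ t ∷ []) xs))) (eval-q j))
      muStepᴾ-eval

  muSearchᴾ-eval : ∀ {n} {q : PR (suc (suc n))} t (xs : Vec ℕ n) {V : ℕ → ℕ} →
    (∀ j → Eval f q (t ∷ j ∷ xs) (V j)) → Eval f (muSearchᴾ q) (t ∷ xs) (pred (muState V t))
  muSearchᴾ-eval t xs {V} eval-q =
    app₁-eval
      (e-comp (ea-∷ e-proj (ea-∷ e-proj (dropᴾ-eval (t ∷ []) xs)))
              (prim-eval (t ∷ xs) (muState V) oneᴾ-eval (λ j → muSearchStepᴾ-eval j (muState V j) t xs eval-q) t))
      predᴾ-eval

  mutual
    runᴾ-eval : ∀ {n} (p : PR n) t xs → Eval f (runᴾ p) (t ∷ xs) (run p t xs)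
    runᴾ-eval zer         t xs       = oneᴾ-eval
    runᴾ-eval succ        t (x ∷ []) = app₁-eval (app₁-eval e-proj e-succ) e-succ
    runᴾ-eval (proj i)    t xs       = app₁-eval e-proj e-succ
    runᴾ-eval orc         t xs       = oneᴾ-eval
    runᴾ-eval (comp g hs) t xs       =
      e-comp (ea-∷ (e-comp (ea-∷ e-proj (predsᴾ-eval (runAllᴾ-eval hs t xs))) (runᴾ-eval g t _))
                   (runAllᴾ-eval hs t xs))
             (guardAllᴾ-eval _ _)
    runᴾ-eval (prim h g)  t (k ∷ xs) = primRunᴾ-eval t k xs (runᴾ-eval h t xs) (λ j r → runᴾ-eval g t (j ∷ r ∷ xs))
    runᴾ-eval (mu g)      t xs       = muSearchᴾ-eval t xs (λ j → runᴾ-eval g t (j ∷ xs))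

    runAllᴾ-eval : ∀ {n m} (hs : Vec (PR n) m) t xs → EvalAll f (runAllᴾ hs) (t ∷ xs) (runAll hs t xs)
    runAllᴾ-eval []       t xs = ea-[]
    runAllᴾ-eval (h ∷ hs) t xs = ea-∷ (runᴾ-eval h t xs) (runAllᴾ-eval hs t xs)

RejectedBelow : (ℕ → ℕ) → ℕ → Set
RejectedBelow V y = ∀ z → z < y → ∃ λ w → V z ≡ 2 + w

muState-searching : ∀ V j → muState V j ≡ 1 → RejectedBelow V j
muState-searching V (suc j) eq z z<1+j with muState V j in state-j | V j in Vj
muState-searching V (suc j) () z z<1+j | zero          | _
muState-searching V (suc j) () z z<1+j | suc zero      | zero
muState-searching V (suc j) () z z<1+j | suc zero      | suc zero
muState-searching V (suc j) eq z z<1+j | suc zero      | suc (suc w) with m<1+n⇒m<n∨m≡n z<1+j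
... | inj₁ z<j  = muState-searching V j state-j z z<j
... | inj₂ refl = w , Vj
muState-searching V (suc j) () z z<1+j | suc (suc y)   | _

muState-found : ∀ V j y → muState V j ≡ 2 + y → V y ≡ 1 × RejectedBelow V y
muState-found V (suc j) y eq with muState V j in state-j | V j in Vj
muState-found V (suc j) y () | zero        | _
muState-found V (suc j) y () | suc zero    | zero
muState-found V (suc j) y refl | suc zero  | suc zero = Vj , muState-searching V j state-j
muState-found V (suc j) y () | suc zero    | suc (suc w)
muState-found V (suc j) y refl | suc (suc s) | _ = muState-found V j y state-j

muState-before : ∀ V y → RejectedBelow V y → ∀ j → j ≤ y → muState V j ≡ 1
muState-before V y rejected zero    _       = refl
muState-before V y rejected (suc j) 1+j≤y
  with muState-before V y rejected j (<⇒≤ 1+j≤y) | rejected j 1+j≤y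
... | state-j | w , Vj rewrite state-j | Vj = refl

muState-after : ∀ V y → V y ≡ 1 → RejectedBelow V y → ∀ j → y < j → muState V j ≡ 2 + y
muState-after V y Vy rejected (suc j) (s≤s y≤j) with m≤n⇒m<n∨m≡n y≤j
... | inj₂ refl rewrite muState-before V y rejected y ≤-refl | Vy = refl
... | inj₁ y<j  rewrite muState-after V y Vy rejected j y<j = refl

noOracle : ℕ → ℕ
noOracle _ = 0

pred≡suc⇒≡2+ : ∀ {u y} → pred u ≡ suc y → u ≡ 2 + y
pred≡suc⇒≡2+ {suc u} refl = refl

mutual
  run-sound : ∀ {n} (p : PR n) t xs {y} → run p t xs ≡ suc y → Eval noOracle p xs y
  run-sound zer         t xs       refl = e-zer
  run-sound succ        t (x ∷ []) refl = e-succ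
  run-sound (proj i)    t xs       refl = e-proj
  run-sound orc         t (x ∷ []) refl = e-orc
  run-sound (comp g hs) t xs       eq   with runAll-sound hs t xs eq
  ... | evals , eq-g = e-comp evals (run-sound g t _ eq-g)
  run-sound (prim h g)  t (k ∷ xs) eq   = primRun-sound h g t xs k eq
  run-sound (mu g)      t xs       eq   with muState-found (λ j → run g t (j ∷ xs)) t _ (pred≡suc⇒≡2+ eq)
  ... | at-y , rejected = e-mu (mu-least _ (run-sound g t _ at-y)
          (λ z z<y → let (w , eq-z) = rejected z z<y in w , run-sound g t _ eq-z))

  runAll-sound : ∀ {n m} (hs : Vec (PR n) m) t xs {r y} → guardAll (runAll hs t xs) r ≡ suc y →
    EvalAll noOracle hs xs (map pred (runAll hs t xs)) × r ≡ suc y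
  runAll-sound []       t xs eq = ea-[] , eq
  runAll-sound (h ∷ hs) t xs eq with run h t xs in eq-h
  runAll-sound (h ∷ hs) t xs () | zero
  runAll-sound (h ∷ hs) t xs eq | suc v with runAll-sound hs t xs eq
  ... | evals , eq-r = ea-∷ (run-sound h t xs eq-h) evals , eq-r

  primRun-sound : ∀ {n} (h : PR n) g t xs k {y} → run (prim h g) t (k ∷ xs) ≡ suc y →
    Eval noOracle (prim h g) (k ∷ xs) y
  primRun-sound h g t xs zero    eq = e-prim-z (run-sound h t xs eq)
  primRun-sound h g t xs (suc k) eq with run (prim h g) t (k ∷ xs) in eq-k
  primRun-sound h g t xs (suc k) () | zero
  primRun-sound h g t xs (suc k) eq | suc r = e-prim-s (primRun-sound h g t xs k eq-k) (run-sound g t _ eq)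

Eventually : (ℕ → Set) → Set
Eventually P = ∃ λ T → ∀ t → T ≤ t → P t

eventually-× : ∀ {P Q : ℕ → Set} → Eventually P → Eventually Q → Eventually (λ t → P t × Q t)
eventually-× (T₁ , p) (T₂ , q) =
  T₁ ⊔ T₂ , λ t le → p t (≤-trans (m≤m⊔n T₁ T₂) le) , q t (≤-trans (m≤n⊔m T₁ T₂) le)

eventually-map : ∀ {P Q : ℕ → Set} → (∀ {t} → P t → Q t) → Eventually P → Eventually Q
eventually-map f (T , p) = T , λ t le → f (p t le)

always : ∀ {P : ℕ → Set} → (∀ t → P t) → Eventually P
always p = 0 , λ t _ → p t

mutual
  run-complete : ∀ {n} {p : PR n} {xs y} → Eval noOracle p xs y → Eventually (λ t → run p t xs ≡ suc y)
  run-complete e-zer   = always λ _ → refl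
  run-complete e-succ  = always λ _ → refl
  run-complete e-proj  = always λ _ → refl
  run-complete e-orc   = always λ _ → refl
  run-complete (e-comp {g = g} {hs} {xs} {ys} {y} evals eval-g) =
    eventually-map (λ (eq-hs , eq-g) → run-comp eq-hs eq-g)
      (eventually-× (runAll-complete evals) (run-complete eval-g))
    where
    run-comp : ∀ {t} → runAll hs t xs ≡ map suc ys → run g t ys ≡ suc y → run (comp g hs) t xs ≡ suc y
    run-comp {t} eq-hs eq-g = begin
      guardAll (runAll hs t xs) (run g t (map pred (runAll hs t xs)))
        ≡⟨ cong (λ vs → guardAll vs (run g t (map pred vs))) eq-hs ⟩
      guardAll (map suc ys) (run g t (map pred (map suc ys)))
        ≡⟨ guardAll-map-suc ys _ ⟩
      run g t (map pred (map suc ys))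
        ≡⟨ cong (run g t) (map-pred-suc ys) ⟩
      run g t ys
        ≡⟨ eq-g ⟩
      suc y ∎
      where open ≡-Reasoning
  run-complete (e-prim-z eval-h) = run-complete eval-h
  run-complete (e-prim-s {g = g} {k} {xs} eval-k eval-g) =
    eventually-map (λ (eq-k , eq-g) → trans (cong (λ u → guard u (run g _ (k ∷ pred u ∷ xs))) eq-k) eq-g)
      (eventually-× (run-complete eval-k) (run-complete eval-g))
  run-complete (e-mu {g = g} {xs} {y} found) with muFrom-complete found
  ... | T , p = T ⊔ suc y , λ t le →
    let (at-y , rejected) = p t (≤-trans (m≤m⊔n T (suc y)) le)
    in cong pred (muState-after (λ j → run g t (j ∷ xs)) y at-y (λ z → rejected z z≤n) t
                   (≤-trans (m≤n⊔m T (suc y)) le))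

  runAll-complete : ∀ {n m} {hs : Vec (PR n) m} {xs ys} → EvalAll noOracle hs xs ys →
    Eventually (λ t → runAll hs t xs ≡ map suc ys)
  runAll-complete ea-[]               = always λ _ → refl
  runAll-complete (ea-∷ eval-h evals) =
    eventually-map (λ (eq-h , eq-hs) → cong₂ _∷_ eq-h eq-hs)
      (eventually-× (run-complete eval-h) (runAll-complete evals))

  muFrom-complete : ∀ {n} {g : PR (suc n)} {xs k y} → MuFrom noOracle g xs k y →
    Eventually (λ t → run g t (y ∷ xs) ≡ 1 × (∀ z → k ≤ z → z < y → ∃ λ w → run g t (z ∷ xs) ≡ 2 + w))
  muFrom-complete (mu-found eval-k) =
    eventually-map (λ at-k → at-k , λ z k≤z z<k → ⊥-elim (<-irrefl refl (≤-<-trans k≤z z<k)))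
      (run-complete eval-k)
  muFrom-complete {g = g} {xs} {k} (mu-step {v = v} eval-k rest) =
    eventually-map (λ (eq-k , at-y , rejected) → at-y , extend eq-k rejected)
      (eventually-× (run-complete eval-k) (muFrom-complete rest))
    where
    extend : ∀ {t y} → run g t (k ∷ xs) ≡ 2 + v →
      (∀ z → suc k ≤ z → z < y → ∃ λ w → run g t (z ∷ xs) ≡ 2 + w) →
      (∀ z → k ≤ z → z < y → ∃ λ w → run g t (z ∷ xs) ≡ 2 + w)
    extend eq-k rejected z k≤z z<y with m≤n⇒m<n∨m≡n k≤z
    ... | inj₁ k<z  = rejected z k<z z<y
    ... | inj₂ refl = v , eq-k

ifZero-1-0≡0 : ∀ u → ifZero u 1 0 ≡ 0 → ∃ λ s → u ≡ suc s
ifZero-1-0≡0 (suc s) _ = s , refl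

module Search (e : PR 1) where

  Halts : ℕ → Set
  Halts u = ∃ λ y → Eval noOracle e (u ∷ []) y

  accepts : ℕ → ℕ → ℕ
  accepts t u = run e t (u ∷ [])

  Accepted : ℕ → ℕ → Set
  Accepted t u = ∃ λ v → accepts t u ≡ suc v

  accepted⇒halts : ∀ {t u} → Accepted t u → Halts u
  accepted⇒halts {t} (v , eq) = v , run-sound e t _ eq

  -- 1 + the least m < j such that both ⟨φ m , a⟩ and ⟨φ m , b⟩ are accepted within t; 0 if there is none.
  scan : (ℕ → ℕ) → ℕ → ℕ → ℕ → ℕ → ℕ
  scan φ t a b zero    = 0
  scan φ t a b (suc j) =
    ifZero (scan φ t a b j)
      (guard (accepts t (pair (φ j) a)) (guard (accepts t (pair (φ j) b)) (suc j)))
      (scan φ t a b j)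

  scan-sound : ∀ φ t a b j {m} → scan φ t a b j ≡ suc m →
    Accepted t (pair (φ m) a) × Accepted t (pair (φ m) b)
  scan-sound φ t a b (suc j) eq with scan φ t a b j in eq-j
  ... | suc _ = scan-sound φ t a b j (trans eq-j eq)
  ... | zero with accepts t (pair (φ j) a) in acc-a | accepts t (pair (φ j) b) in acc-b
  scan-sound φ t a b (suc j) ()   | zero | zero  | _
  scan-sound φ t a b (suc j) ()   | zero | suc _ | zero
  scan-sound φ t a b (suc j) refl | zero | suc v | suc w = (v , acc-a) , (w , acc-b)

  scan-complete : ∀ φ t a b {m} j → m < j →
    Accepted t (pair (φ m) a) → Accepted t (pair (φ m) b) → ∃ λ s → scan φ t a b j ≡ suc s
  scan-complete φ t a b (suc j) m<1+j acc-a acc-b with scan φ t a b j in eq-j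
  ... | suc s = s , refl
  ... | zero with m<1+n⇒m<n∨m≡n m<1+j
  ...   | inj₁ m<j =
    ⊥-elim (0≢1+n (trans (sym eq-j) (proj₂ (scan-complete φ t a b j m<j acc-a acc-b))))
  scan-complete φ t a b (suc j) _ (_ , eq-a) (_ , eq-b) | zero | inj₂ refl rewrite eq-a | eq-b = j , refl

  scan-eventually-succeeds : ∀ φ a b m → Halts (pair (φ m) a) → Halts (pair (φ m) b) →
    ∃ λ t → ∃ λ s → scan φ t a b t ≡ suc s
  scan-eventually-succeeds φ a b m (_ , halts-a) (_ , halts-b)
    with eventually-× (run-complete halts-a) (run-complete halts-b)
  ... | T , accepted-after-T =
    let (eq-a , eq-b) = accepted-after-T (T ⊔ suc m) (m≤m⊔n T (suc m))
    in T ⊔ suc m , scan-complete φ (T ⊔ suc m) a b (T ⊔ suc m) (m≤n⊔m T (suc m)) (_ , eq-a) (_ , eq-b)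

  acceptsᴾ : PR 5 → PR 5
  acceptsᴾ arg = comp (runᴾ e) (proj (# 2) ∷ app₂ pairᴾ (app₁ orc (proj (# 0))) arg ∷ [])

  scanᴾ : PR 4
  scanᴾ = prim zer (app₃ ifZeroᴾ (proj (# 1))
    (app₂ guardᴾ (acceptsᴾ (proj (# 3))) (app₂ guardᴾ (acceptsᴾ (proj (# 4))) (app₁ succ (proj (# 0)))))
    (proj (# 1)))

  notFound : (ℕ → ℕ) → ℕ → ℕ → ℕ → ℕ
  notFound φ n a t = ifZero (scan φ t a (φ (suc n)) t) 1 0

  notFoundᴾ : PR 3
  notFoundᴾ = app₃ ifZeroᴾ
    (comp scanᴾ (proj (# 0) ∷ proj (# 0) ∷ proj (# 2) ∷ app₁ orc (app₁ succ (proj (# 1))) ∷ []))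
    oneᴾ zer

  refineᴾ : PR 2
  refineᴾ = app₁ orc (app₁ predᴾ
    (comp scanᴾ (mu notFoundᴾ ∷ mu notFoundᴾ ∷ proj (# 1) ∷ app₁ orc (app₁ succ (proj (# 0))) ∷ [])))

  nestedOracleᴾ : PR 1
  nestedOracleᴾ = prim (app₁ orc zer) refineᴾ

  module _ (φ : ℕ → ℕ) where

    acceptsᴾ-eval : ∀ {j s t a b arg u} → Eval φ arg (j ∷ s ∷ t ∷ a ∷ b ∷ []) u →
      Eval φ (acceptsᴾ arg) (j ∷ s ∷ t ∷ a ∷ b ∷ []) (accepts t (pair (φ j) u))
    acceptsᴾ-eval {t = t} eval-arg =
      e-comp (ea-∷ e-proj (ea-∷ (app₂-eval (app₁-eval e-proj e-orc) eval-arg pairᴾ-eval) ea-[]))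
             (runᴾ-eval e t _)

    scanᴾ-eval : ∀ t a b j → Eval φ scanᴾ (j ∷ t ∷ a ∷ b ∷ []) (scan φ t a b j)
    scanᴾ-eval t a b = prim-eval (t ∷ a ∷ b ∷ []) (scan φ t a b) e-zer λ _ →
      app₃-eval e-proj
        (app₂-eval (acceptsᴾ-eval e-proj)
                   (app₂-eval (acceptsᴾ-eval e-proj) (app₁-eval e-proj e-succ) guardᴾ-eval)
                   guardᴾ-eval)
        e-proj ifZeroᴾ-eval

    notFoundᴾ-eval : ∀ n a t → Eval φ notFoundᴾ (t ∷ n ∷ a ∷ []) (notFound φ n a t)
    notFoundᴾ-eval n a t =
      app₃-eval
        (e-comp (ea-∷ e-proj (ea-∷ e-proj (ea-∷ e-proj (ea-∷ (app₁-eval (app₁-eval e-proj e-succ) e-orc) ea-[]))))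
                (scanᴾ-eval t a (φ (suc n)) t))
        oneᴾ-eval e-zer ifZeroᴾ-eval

    refineᴾ-eval : ∀ n a t → MuFrom φ notFoundᴾ (n ∷ a ∷ []) 0 t →
      Eval φ refineᴾ (n ∷ a ∷ []) (φ (pred (scan φ t a (φ (suc n)) t)))
    refineᴾ-eval n a t stops =
      app₁-eval
        (app₁-eval
          (e-comp (ea-∷ (e-mu stops) (ea-∷ (e-mu stops) (ea-∷ e-proj
                    (ea-∷ (app₁-eval (app₁-eval e-proj e-succ) e-orc) ea-[]))))
                  (scanᴾ-eval t a (φ (suc n)) t))
          predᴾ-eval)
        e-orc

    abstract
      refineᴾ-spec : ∀ n a m → Halts (pair (φ m) a) → Halts (pair (φ m) (φ (suc n))) →
        Σ ℕ λ m′ → Eval φ refineᴾ (n ∷ a ∷ []) (φ m′) × Halts (pair (φ m′) a) × Halts (pair (φ m′) (φ (suc n)))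
      refineᴾ-spec n a m halts-a halts-b
        with scan-eventually-succeeds φ a (φ (suc n)) m halts-a halts-b
      ... | t₀ , _ , found₀
        with mu-search (notFound φ n a) (notFoundᴾ-eval n a) 0 t₀ (cong (λ u → ifZero u 1 0) found₀)
      ... | t , stops , not-found≡0
        with ifZero-1-0≡0 (scan φ t a (φ (suc n)) t) not-found≡0
      ... | m′ , found =
        let (acc-a , acc-b) = scan-sound φ t a (φ (suc n)) t found
        in m′ , subst (Eval φ refineᴾ (n ∷ a ∷ [])) (cong (λ u → φ (pred u)) found) (refineᴾ-eval n a t stops)
              , accepted⇒halts acc-a , accepted⇒halts acc-b

module NestedOracle {X : Set} (T : EffectiveTopology X) (e : PR 1)
  (e-enumerates : ∀ k → SubsetCodes T k ⇔ (∃ λ y → Eval noOracle e (k ∷ []) y)) where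

  open EffectiveTopology T
  open Search e

  halts⇒⊆ : ∀ {u w} → Halts (pair u w) → ν u ⊆ ν w
  halts⇒⊆ {u} {w} halts with Equivalence.from (e-enumerates (pair u w)) halts
  ... | u′ , w′ , eq , _ , _ , u′⊆w′ with pair-injective u w u′ w′ eq
  ...   | refl , refl = u′⊆w′

  ⊆⇒halts : ∀ {u w} → dom u → dom w → ν u ⊆ ν w → Halts (pair u w)
  ⊆⇒halts {u} {w} du dw u⊆w = Equivalence.to (e-enumerates (pair u w)) (u , w , refl , du , dw , u⊆w)

  module _ (x : X) (φ : ℕ → ℕ) (φ-oracle : IsOracle T x φ) where

    BasicNbhd : ℕ → Set
    BasicNbhd a = dom a × ν a x

    φ-basic : ∀ n → BasicNbhd (φ n)
    φ-basic = proj₁ φ-oracle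

    φ-local : ∀ b → dom b → ν b x → ∃ λ n → ν (φ n) ⊆ ν b
    φ-local = proj₂ φ-oracle

    common-refinement : ∀ {a b} → BasicNbhd a → BasicNbhd b → ∃ λ m → ν (φ m) ⊆ ν a × ν (φ m) ⊆ ν b
    common-refinement {a} {b} (da , xa) (db , xb) with inter a b x da db xa xb
    ... | c , dc , xc , c⊆a , c⊆b with φ-local c dc xc
    ...   | m , m⊆c = m , (λ p → c⊆a (m⊆c p)) , (λ p → c⊆b (m⊆c p))

    record Step (n a : ℕ) : Set where
      field
        next         : ℕ
        next-eval    : Eval φ refineᴾ (n ∷ a ∷ []) next
        next-basic   : BasicNbhd next
        next⊆current : ν next ⊆ ν a
        next⊆oracle  : ν next ⊆ ν (φ (suc n))

    step : ∀ n {a} → BasicNbhd a → Step n a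
    step n {a} basic-a =
      let (m , m⊆a , m⊆φ) = common-refinement basic-a (φ-basic (suc n))
          (m′ , eval , halts-a , halts-φ) = refineᴾ-spec φ n a m
            (⊆⇒halts (proj₁ (φ-basic m)) (proj₁ basic-a) m⊆a)
            (⊆⇒halts (proj₁ (φ-basic m)) (proj₁ (φ-basic (suc n))) m⊆φ)
      in record
        { next         = φ m′
        ; next-eval    = eval
        ; next-basic   = φ-basic m′
        ; next⊆current = halts⇒⊆ halts-a
        ; next⊆oracle  = halts⇒⊆ halts-φ
        }

    chain : ℕ → Σ ℕ BasicNbhd
    chain zero    = φ 0 , φ-basic 0
    chain (suc n) = Step.next (step n (proj₂ (chain n))) , Step.next-basic (step n (proj₂ (chain n)))

    ψ : ℕ → ℕ
    ψ n = proj₁ (chain n)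

    ψ-step : ∀ n → Step n (ψ n)
    ψ-step n = step n (proj₂ (chain n))

    ψ-eval : ∀ n → Eval φ nestedOracleᴾ (n ∷ []) (ψ n)
    ψ-eval = prim-eval [] ψ (app₁-eval e-zer e-orc) (λ n → Step.next-eval (ψ-step n))

    ψ-oracle : IsOracle T x ψ
    ψ-oracle = (λ n → proj₂ (chain n)) , local
      where
      local : ∀ b → dom b → ν b x → ∃ λ n → ν (ψ n) ⊆ ν b
      local b db xb with φ-local b db xb
      ... | zero  , φ0⊆b = 0 , φ0⊆b
      ... | suc n , φn⊆b = suc n , λ p → φn⊆b (Step.next⊆oracle (ψ-step n) p)

    ψ-nested : Nested T ψ
    ψ-nested n = Step.next⊆current (ψ-step n)

theorem8 : {X : Set} (T : EffectiveTopology X) → SubsetRE T →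
    Σ (PR 1) λ e → ∀ (x : X) (φ : ℕ → ℕ) → IsOracle T x φ →
      Σ (ℕ → ℕ) λ ψ → (∀ n → Eval φ e (n ∷ []) (ψ n)) × IsOracle T x ψ × Nested T ψ
theorem8 T (e , e-enumerates) = Search.nestedOracleᴾ e , λ x φ φ-oracle →
  let open NestedOracle T e e-enumerates in
  ψ x φ φ-oracle , ψ-eval x φ φ-oracle , ψ-oracle x φ φ-oracle , ψ-nested x φ φ-oracle
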